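{- Let $\mathcal A_n=\mathrm{Av}_n(123,321)$. Then $\mathrm{pop}_{\mathcal A}(132)=\mathrm{pop}_{\mathcal A}(231)=\mathrm{pop}_{\mathcal A}(312)=\mathrm{pop}_{\mathcal A}(213)=1/4$.
   Context: A permutation $\pi=a_1\dots a_n$ contains a consecutive occurrence of a pattern $p\in\mathcal S_r$ at position $i$ if $a_i\dots a_{i+r-1}$ is order-isomorphic to $p$; $\mathrm{Av}_n(p_1,\dots,p_k)$ is the set of permutations of size $n$ with no consecutive occurrence of any $p_j$. For a class $\mathcal A_n$ and a pattern $p$, $\mathbf p_n^{\mathcal A}$ is the total number of consecutive occurrences of $p$ over all permutations of $\mathcal A_n$, and $\mathrm{pop}_{\mathcal A}(p)=\lim_{n\to\infty}\frac{\mathbf p_n^{\mathcal A}}{n|\mathcal A_n|}$ when it exists. -}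

module Defs where

open import Data.Bool using (Bool; true; false; not; _∧_; if_then_else_)
open import Data.Nat using (ℕ; zero; suc; _+_; _*_; _≤_; _<ᵇ_; _≡ᵇ_)
open import Data.List using (List; []; _∷_; map; concatMap; upTo; filterᵇ; length; take; zipWith)
open import Data.Bool.ListAction using (and; all)
open import Data.Nat.ListAction using (sum)
open import Data.Integer using (+_)
open import Data.Rational using (ℚ; 0ℚ; _/_; _-_; ∣_∣; _<_)
open import Data.Product using (∃)

words : ℕ → ℕ → List (List ℕ)
words m zero    = [] ∷ []
words m (suc n) = concatMap (λ w → map (_∷ w) (upTo m)) (words m n)

elemᵇ : ℕ → List ℕ → Bool
elemᵇ x []       = false
elemᵇ x (y ∷ ys) = (x ≡ᵇ y) Data.Bool.∨ elemᵇ x ys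

distinctᵇ : List ℕ → Bool
distinctᵇ []       = true
distinctᵇ (x ∷ xs) = not (elemᵇ x xs) ∧ distinctᵇ xs

perms : ℕ → List (List ℕ)
perms n = filterᵇ distinctᵇ (words n n)

_⇔ᵇ_ : Bool → Bool → Bool
true  ⇔ᵇ b = b
false ⇔ᵇ b = not b

orderIsoᵇ : List ℕ → List ℕ → Bool
orderIsoᵇ u v =
  (length u ≡ᵇ length v) ∧
  and (zipWith (λ a b → and (zipWith (λ c d → (a <ᵇ c) ⇔ᵇ (b <ᵇ d)) u v)) u v)

occ : List ℕ → List ℕ → ℕ
occ p w = go w
  where
    go : List ℕ → ℕ
    go []         = 0
    go (x ∷ xs)   = (if orderIsoᵇ p (take (length p) (x ∷ xs)) then 1 else 0) + go xs

Av : List (List ℕ) → ℕ → List (List ℕ)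
Av ps n = filterᵇ (λ w → all (λ p → occ p w ≡ᵇ 0) ps) (perms n)

totalOcc : (ℕ → List (List ℕ)) → List ℕ → ℕ → ℕ
totalOcc A p n = sum (map (occ p) (A n))

-- a / b as a rational (with the convention a / 0 = 0, irrelevant for the limit).
ratio : ℕ → ℕ → ℚ
ratio a zero    = 0ℚ
ratio a (suc b) = (+ a) / suc b

popSeq : (ℕ → List (List ℕ)) → List ℕ → ℕ → ℚ
popSeq A p n = ratio (totalOcc A p n) (n * length (A n))

ConvergesTo : (ℕ → ℚ) → ℚ → Set
ConvergesTo a L = ∀ (ε : ℚ) → 0ℚ < ε → ∃ λ N → ∀ n → N ≤ n → ∣ a n - L ∣ < ε

PopEq : (ℕ → List (List ℕ)) → List ℕ → ℚ → Set
PopEq A p L = ConvergesTo (popSeq A p) L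

𝒜 : ℕ → List (List ℕ)
𝒜 = Av ((1 ∷ 2 ∷ 3 ∷ []) ∷ (3 ∷ 2 ∷ 1 ∷ []) ∷ [])

-- In a permutation avoiding 123 and 321 every window of three consecutive letters is an
-- occurrence of exactly one of 132, 213, 231 and 312, so the four totals 𝐩ₙ add up to
-- (n − 2)|𝒜ₙ|. Reversal maps 𝒜ₙ onto itself and turns occurrences of 132 into occurrences
-- of 231; complementation does the same for 132 ↔ 312 and 231 ↔ 213. Hence each of the four
-- totals equals (n − 2)|𝒜ₙ|/4, and as 𝒜ₙ is never empty (it contains 1 0 3 2 5 4 …) the
-- ratio 𝐩ₙ/(n|𝒜ₙ|) is (n − 2)/4n, which tends to 1/4.
module Submission where

open import Data.Bool using (Bool; true; false; not; _∧_; _∨_; if_then_else_)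
open import Data.Bool.ListAction using (all)
open import Data.Bool.Properties using (T-≡; ¬-not; ∨-assoc; ∨-comm; ∨-identityʳ)
open import Data.Integer as ℤ using (ℤ; -[1+_]; +[1+_])
import Data.Integer.Properties as ℤ
open import Data.List using (List; []; _∷_; _++_; _∷ʳ_; map; concatMap; reverse; length; upTo; applyUpTo; filterᵇ)
open import Data.List.Membership.Propositional using (_∈_; find; lose)
open import Data.List.Membership.Propositional.Properties
  using (∈-map⁺; ∈-map⁻; ∈-concatMap⁺; ∈-concatMap⁻; ∈-upTo⁺; ∈-upTo⁻)
open import Data.List.Properties
  using (map-++; map-cong; map-cong-local; map-∘; unfold-reverse; reverse-++; upTo-∷ʳ; map-upTo; filter-some)
open import Data.List.Relation.Unary.All using (All; []; _∷_)
import Data.List.Relation.Unary.All as All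
open import Data.List.Relation.Unary.Any using (here; there)
import Data.List.Relation.Unary.Any as Any
open import Data.Nat using (ℕ; zero; suc; _+_; _*_; _∸_; _≤_; _<_; _<ᵇ_; _≡ᵇ_; z≤n; s≤s; s<s; _<?_)
open import Data.Nat.Coprimality using (Coprime)
open import Data.Nat.ListAction using (sum)
open import Data.Nat.ListAction.Properties using (sum-++)
open import Data.Nat.Properties
open import Algebra.Properties.CommutativeSemigroup +-commutativeSemigroup using (interchange)
open import Data.Nat.Solver using (module +-*-Solver)
open import Data.Product using (_×_; _,_; ∃; proj₁; proj₂; swap)
open import Data.Rational as ℚ using (ℚ; mkℚ; _/_; toℚᵘ; fromℚᵘ)
import Data.Rational.Properties as ℚ
open import Data.Rational.Unnormalised as ℚᵘ using (mkℚᵘ)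
import Data.Rational.Unnormalised.Properties as ℚᵘ
open import Data.Sum using (_⊎_; inj₁; inj₂)
open import Function using (id; _∘_; _⇔_; mk⇔; Equivalence)
open import Relation.Binary using (tri<; tri≈; tri>)
open import Relation.Binary.PropositionalEquality
open import Relation.Nullary using (¬_; contradiction; yes; no)
open import Relation.Nullary.Decidable using (T?)

open import Defs

private variable A B : Set

∑ : List A → (A → ℕ) → ℕ
∑ xs f = sum (map f xs)

∑-cong : ∀ xs {f g : A → ℕ} → (∀ x → f x ≡ g x) → ∑ xs f ≡ ∑ xs g
∑-cong xs f≗g = cong sum (map-cong f≗g xs)

∑-congᴬ : ∀ {xs} {f g : A → ℕ} → All (λ x → f x ≡ g x) xs → ∑ xs f ≡ ∑ xs g
∑-congᴬ = cong sum ∘ map-cong-local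

∑-++ : ∀ xs ys (f : A → ℕ) → ∑ (xs ++ ys) f ≡ ∑ xs f + ∑ ys f
∑-++ xs ys f = trans (cong sum (map-++ f xs ys)) (sum-++ (map f xs) (map f ys))

∑-map : ∀ xs (g : A → B) (f : B → ℕ) → ∑ (map g xs) f ≡ ∑ xs (f ∘ g)
∑-map xs g f = cong sum (sym (map-∘ xs))

∑-concatMap : ∀ xs (h : A → List B) (f : B → ℕ) → ∑ (concatMap h xs) f ≡ ∑ xs (λ x → ∑ (h x) f)
∑-concatMap []       h f = refl
∑-concatMap (x ∷ xs) h f = trans (∑-++ (h x) (concatMap h xs) f) (cong (∑ (h x) f +_) (∑-concatMap xs h f))

∑-+ : ∀ xs (f g : A → ℕ) → ∑ xs (λ x → f x + g x) ≡ ∑ xs f + ∑ xs g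
∑-+ []       f g = refl
∑-+ (x ∷ xs) f g = trans (cong (f x + g x +_) (∑-+ xs f g)) (interchange (f x) (g x) _ _)

∑-swap : ∀ xs ys (f : A → B → ℕ) → ∑ xs (λ x → ∑ ys (f x)) ≡ ∑ ys (λ y → ∑ xs (λ x → f x y))
∑-swap []       ys f = sym (∑-zero ys)
  where
  ∑-zero : ∀ (ys : List B) → ∑ ys (λ _ → 0) ≡ 0
  ∑-zero []       = refl
  ∑-zero (_ ∷ ys) = ∑-zero ys
∑-swap (x ∷ xs) ys f = trans (cong (∑ ys (f x) +_) (∑-swap xs ys f)) (sym (∑-+ ys (f x) _))

∑-∷ʳ : ∀ xs y (f : A → ℕ) → ∑ (xs ∷ʳ y) f ≡ ∑ xs f + f y
∑-∷ʳ xs y f = trans (∑-++ xs (y ∷ []) f) (cong (∑ xs f +_) (+-identityʳ (f y)))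

∑-reverse : ∀ xs (f : A → ℕ) → ∑ (reverse xs) f ≡ ∑ xs f
∑-reverse []       f = refl
∑-reverse (x ∷ xs) f = begin
  ∑ (reverse (x ∷ xs)) f ≡⟨ cong (λ l → ∑ l f) (unfold-reverse x xs) ⟩
  ∑ (reverse xs ∷ʳ x) f  ≡⟨ ∑-∷ʳ (reverse xs) x f ⟩
  ∑ (reverse xs) f + f x ≡⟨ cong (_+ f x) (∑-reverse xs f) ⟩
  ∑ xs f + f x           ≡⟨ +-comm (∑ xs f) (f x) ⟩
  ∑ (x ∷ xs) f           ∎
  where open ≡-Reasoning

∑≡0⇒All : ∀ xs {f : A → ℕ} → ∑ xs f ≡ 0 → All (λ x → f x ≡ 0) xs
∑≡0⇒All []       _ = []
∑≡0⇒All (x ∷ xs) {f} h = m+n≡0⇒m≡0 (f x) h ∷ ∑≡0⇒All xs (m+n≡0⇒n≡0 (f x) h)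

∑-const : ∀ (xs : List A) k → ∑ xs (λ _ → k) ≡ k * length xs
∑-const []       k = sym (*-zeroʳ k)
∑-const (_ ∷ xs) k = trans (cong (k +_) (∑-const xs k)) (sym (*-suc k (length xs)))

∑-filterᵇ : ∀ (P : A → Bool) xs (f : A → ℕ) → ∑ (filterᵇ P xs) f ≡ ∑ xs (λ x → if P x then f x else 0)
∑-filterᵇ P []       f = refl
∑-filterᵇ P (x ∷ xs) f with P x
... | true  = cong (f x +_) (∑-filterᵇ P xs f)
... | false = ∑-filterᵇ P xs f

∑-filterᵇ-congᴬ : ∀ (P : A → Bool) {xs} {f g : A → ℕ} → All (λ x → P x ≡ true → f x ≡ g x) xs →
                  ∑ (filterᵇ P xs) f ≡ ∑ (filterᵇ P xs) g
∑-filterᵇ-congᴬ P {[]}     []            = refl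
∑-filterᵇ-congᴬ P {x ∷ xs} (f≡g ∷ fs≡gs) with P x
... | true  = cong₂ _+_ (f≡g refl) (∑-filterᵇ-congᴬ P fs≡gs)
... | false = ∑-filterᵇ-congᴬ P fs≡gs

∑-filterᵇ-invariant : ∀ (P : A → Bool) xs (σ : A → A) → (∀ F → ∑ xs (F ∘ σ) ≡ ∑ xs F) →
                      All (λ x → P (σ x) ≡ P x) xs → ∀ f → ∑ (filterᵇ P xs) (f ∘ σ) ≡ ∑ (filterᵇ P xs) f
∑-filterᵇ-invariant P xs σ ∑-σ Pσ≡P f = begin
  ∑ (filterᵇ P xs) (f ∘ σ)
    ≡⟨ ∑-filterᵇ P xs (f ∘ σ) ⟩
  ∑ xs (λ x → if P x then f (σ x) else 0)
    ≡⟨ ∑-congᴬ (All.map (λ e → cong (λ b → if b then _ else 0) (sym e)) Pσ≡P) ⟩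
  ∑ xs (λ x → if P (σ x) then f (σ x) else 0)
    ≡⟨ ∑-σ (λ x → if P x then f x else 0) ⟩
  ∑ xs (λ x → if P x then f x else 0)
    ≡⟨ ∑-filterᵇ P xs f ⟨
  ∑ (filterᵇ P xs) f ∎
  where open ≡-Reasoning

filterᵇ-filterᵇ : ∀ (P Q : A → Bool) xs → filterᵇ P (filterᵇ Q xs) ≡ filterᵇ (λ x → Q x ∧ P x) xs
filterᵇ-filterᵇ P Q []       = refl
filterᵇ-filterᵇ P Q (x ∷ xs) with Q x
... | false = filterᵇ-filterᵇ P Q xs
... | true with P x
...   | true  = cong (x ∷_) (filterᵇ-filterᵇ P Q xs)
...   | false = filterᵇ-filterᵇ P Q xs

∑-words-cons : ∀ m k (F : List ℕ → ℕ) →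
  ∑ (words m (suc k)) F ≡ ∑ (words m k) (λ w → ∑ (upTo m) (λ a → F (a ∷ w)))
∑-words-cons m k F =
  trans (∑-concatMap (words m k) _ F) (∑-cong (words m k) (λ w → ∑-map (upTo m) (_∷ w) F))

∑-words-snoc : ∀ m k (F : List ℕ → ℕ) →
  ∑ (words m (suc k)) F ≡ ∑ (words m k) (λ w → ∑ (upTo m) (λ a → F (w ∷ʳ a)))
∑-words-snoc m zero    F = ∑-words-cons m zero F
∑-words-snoc m (suc k) F = begin
  ∑ (words m (suc (suc k))) F
    ≡⟨ ∑-words-cons m (suc k) F ⟩
  ∑ (words m (suc k)) (λ w → ∑ (upTo m) (λ a → F (a ∷ w)))
    ≡⟨ ∑-words-snoc m k _ ⟩
  ∑ (words m k) (λ v → ∑ (upTo m) (λ b → ∑ (upTo m) (λ a → F (a ∷ v ∷ʳ b))))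
    ≡⟨ ∑-cong (words m k) (λ v → ∑-swap (upTo m) (upTo m) _) ⟩
  ∑ (words m k) (λ v → ∑ (upTo m) (λ a → ∑ (upTo m) (λ b → F (a ∷ v ∷ʳ b))))
    ≡⟨ ∑-words-cons m k _ ⟨
  ∑ (words m (suc k)) (λ w → ∑ (upTo m) (λ a → F (w ∷ʳ a))) ∎
  where open ≡-Reasoning

∑-words-reverse : ∀ m k (F : List ℕ → ℕ) → ∑ (words m k) (F ∘ reverse) ≡ ∑ (words m k) F
∑-words-reverse m zero    F = refl
∑-words-reverse m (suc k) F = begin
  ∑ (words m (suc k)) (F ∘ reverse)
    ≡⟨ ∑-words-cons m k _ ⟩
  ∑ (words m k) (λ w → ∑ (upTo m) (λ a → F (reverse (a ∷ w))))
    ≡⟨ ∑-cong (words m k) (λ w → ∑-cong (upTo m) (λ a → cong F (unfold-reverse a w))) ⟩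
  ∑ (words m k) (λ w → ∑ (upTo m) (λ a → F (reverse w ∷ʳ a)))
    ≡⟨ ∑-words-reverse m k (λ v → ∑ (upTo m) (λ a → F (v ∷ʳ a))) ⟩
  ∑ (words m k) (λ v → ∑ (upTo m) (λ a → F (v ∷ʳ a)))
    ≡⟨ ∑-words-snoc m k F ⟨
  ∑ (words m (suc k)) F ∎
  where open ≡-Reasoning

complement : ℕ → ℕ → ℕ
complement m a = m ∸ suc a

applyUpTo-complement : ∀ m → applyUpTo (complement m) m ≡ reverse (upTo m)
applyUpTo-complement zero    = refl
applyUpTo-complement (suc m) = begin
  m ∷ applyUpTo (complement m) m ≡⟨ cong (m ∷_) (applyUpTo-complement m) ⟩
  m ∷ reverse (upTo m)           ≡⟨ reverse-++ (upTo m) (m ∷ []) ⟨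
  reverse (upTo m ∷ʳ m)          ≡⟨ cong reverse (upTo-∷ʳ m) ⟩
  reverse (upTo (suc m))         ∎
  where open ≡-Reasoning

∑-upTo-complement : ∀ m (g : ℕ → ℕ) → ∑ (upTo m) (g ∘ complement m) ≡ ∑ (upTo m) g
∑-upTo-complement m g = begin
  ∑ (upTo m) (g ∘ complement m)     ≡⟨ ∑-map (upTo m) (complement m) g ⟨
  ∑ (map (complement m) (upTo m)) g ≡⟨ cong (λ l → ∑ l g) (map-upTo (complement m) m) ⟩
  ∑ (applyUpTo (complement m) m) g  ≡⟨ cong (λ l → ∑ l g) (applyUpTo-complement m) ⟩
  ∑ (reverse (upTo m)) g            ≡⟨ ∑-reverse (upTo m) g ⟩
  ∑ (upTo m) g                      ∎
  where open ≡-Reasoning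

∑-words-complement : ∀ m k (F : List ℕ → ℕ) →
  ∑ (words m k) (F ∘ map (complement m)) ≡ ∑ (words m k) F
∑-words-complement m zero    F = refl
∑-words-complement m (suc k) F = begin
  ∑ (words m (suc k)) (F ∘ map (complement m))
    ≡⟨ ∑-words-cons m k _ ⟩
  ∑ (words m k) (λ w → ∑ (upTo m) (λ a → F (complement m a ∷ map (complement m) w)))
    ≡⟨ ∑-cong (words m k) (λ w → ∑-upTo-complement m (λ b → F (b ∷ map (complement m) w))) ⟩
  ∑ (words m k) (λ w → ∑ (upTo m) (λ a → F (a ∷ map (complement m) w)))
    ≡⟨ ∑-words-complement m k (λ v → ∑ (upTo m) (λ a → F (a ∷ v))) ⟩
  ∑ (words m k) (λ v → ∑ (upTo m) (λ a → F (a ∷ v)))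
    ≡⟨ ∑-words-cons m k F ⟨
  ∑ (words m (suc k)) F ∎
  where open ≡-Reasoning

∈-words⁻ : ∀ m k {w} → w ∈ words m k → length w ≡ k × All (_< m) w
∈-words⁻ m zero    (here refl) = refl , []
∈-words⁻ m (suc k) w∈
  with v , v∈ , w∈′ ← find (∈-concatMap⁻ (λ v → map (_∷ v) (upTo m)) {xs = words m k} w∈)
  with a , a∈ , refl ← ∈-map⁻ (_∷ v) w∈′
  with |v|≡k , v<m ← ∈-words⁻ m k v∈
  = cong suc |v|≡k , ∈-upTo⁻ a∈ ∷ v<m

∈-words⁺ : ∀ m {w} → All (_< m) w → w ∈ words m (length w)
∈-words⁺ m []          = here refl
∈-words⁺ m (a<m ∷ w<m) =
  ∈-concatMap⁺ (λ v → map (_∷ v) (upTo m)) (Any.map (λ { refl → ∈-map⁺ (_∷ _) (∈-upTo⁺ a<m) }) (∈-words⁺ m w<m))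

words-bounded : ∀ n → All (All (_< n)) (words n n)
words-bounded n = All.tabulate (proj₂ ∘ ∈-words⁻ n n)

Triple : Set
Triple = ℕ × ℕ × ℕ

⟦_⟧ : Triple → List ℕ
⟦ x , y , z ⟧ = x ∷ y ∷ z ∷ []

matches : Triple → Triple → Bool
matches p t = orderIsoᵇ ⟦ p ⟧ ⟦ t ⟧

reverse₃ : Triple → Triple
reverse₃ (x , y , z) = z , y , x

map₃ : (ℕ → ℕ) → Triple → Triple
map₃ f (x , y , z) = f x , f y , f z

Agree : ℕ → ℕ → ℕ → ℕ → Set
Agree a b x y = ((a <ᵇ b) ≡ (x <ᵇ y)) × ((b <ᵇ a) ≡ (y <ᵇ x))

infix 4 _≅_ _≅ᵒᵖ_

_≅_ : Triple → Triple → Set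
(a , b , c) ≅ (x , y , z) = Agree a b x y × Agree a c x z × Agree b c y z

-- p ≅ᵒᵖ t: t is order-isomorphic to the complement of p. If q is the complement of a
-- concrete pattern p, then p ≅ᵒᵖ t and q ≅ t are the same type.
_≅ᵒᵖ_ : Triple → Triple → Set
(a , b , c) ≅ᵒᵖ (x , y , z) = Agree b a x y × Agree c a x z × Agree c b y z

<⇒<ᵇ≡true : ∀ {m n} → m < n → (m <ᵇ n) ≡ true
<⇒<ᵇ≡true = Equivalence.to T-≡ ∘ <⇒<ᵇ

<ᵇ≡true⇒< : ∀ m n → (m <ᵇ n) ≡ true → m < n
<ᵇ≡true⇒< m n = <ᵇ⇒< m n ∘ Equivalence.from T-≡

≮⇒<ᵇ≡false : ∀ {m n} → ¬ m < n → (m <ᵇ n) ≡ false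
≮⇒<ᵇ≡false {m} {n} m≮n with m <ᵇ n in eq
... | false = refl
... | true  = contradiction (<ᵇ≡true⇒< m n eq) m≮n

n<ᵇn≡false : ∀ n → (n <ᵇ n) ≡ false
n<ᵇn≡false n = ≮⇒<ᵇ≡false {n} {n} (<-irrefl refl)

⇔ᵇ⇒≡ : ∀ {u v} → (u ⇔ᵇ v) ≡ true → u ≡ v
⇔ᵇ⇒≡ {true}  {true}  _ = refl
⇔ᵇ⇒≡ {false} {false} _ = refl

≡⇒⇔ᵇ : ∀ {u v} → u ≡ v → (u ⇔ᵇ v) ≡ true
≡⇒⇔ᵇ {true}  refl = refl
≡⇒⇔ᵇ {false} refl = refl

≡true⇔⇒≡ : ∀ {u v} → (u ≡ true ⇔ v ≡ true) → u ≡ v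
≡true⇔⇒≡ {true}  {true}  _   = refl
≡true⇔⇒≡ {true}  {false} u⇔v = sym (Equivalence.to u⇔v refl)
≡true⇔⇒≡ {false} {true}  u⇔v = Equivalence.from u⇔v refl
≡true⇔⇒≡ {false} {false} _   = refl

and₃⁻ : ∀ u v w → (u ∧ (v ∧ (w ∧ true))) ≡ true → (u ≡ true) × (v ≡ true) × (w ≡ true)
and₃⁻ true true true _ = refl , refl , refl

and₃⁺ : ∀ {u v w} → u ≡ true → v ≡ true → w ≡ true → (u ∧ (v ∧ (w ∧ true))) ≡ true
and₃⁺ refl refl refl = refl

cell : ℕ → ℕ → ℕ → ℕ → Bool
cell a b x y = (a <ᵇ b) ⇔ᵇ (x <ᵇ y)

-- matches p t unfolds to the conjunction of the rows row p t pᵢ tᵢ; the conjuncts are named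
-- explicitly below because unification cannot split a conjunction.
row : Triple → Triple → ℕ → ℕ → Bool
row (a , b , c) (x , y , z) u v = cell u a v x ∧ (cell u b v y ∧ (cell u c v z ∧ true))

matches⇒≅ : ∀ p t → matches p t ≡ true → p ≅ t
matches⇒≅ p@(a , b , c) t@(x , y , z) h
  with r₁ , r₂ , r₃ ← and₃⁻ (row p t a x) (row p t b y) (row p t c z) h
  with _  , ab , ac ← and₃⁻ (cell a a x x) (cell a b x y) (cell a c x z) r₁
  with ba , _  , bc ← and₃⁻ (cell b a y x) (cell b b y y) (cell b c y z) r₂
  with ca , cb , _  ← and₃⁻ (cell c a z x) (cell c b z y) (cell c c z z) r₃
  = (⇔ᵇ⇒≡ ab , ⇔ᵇ⇒≡ ba) , (⇔ᵇ⇒≡ ac , ⇔ᵇ⇒≡ ca) , (⇔ᵇ⇒≡ bc , ⇔ᵇ⇒≡ cb)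

≅⇒matches : ∀ p t → p ≅ t → matches p t ≡ true
≅⇒matches (a , b , c) (x , y , z) ((ab , ba) , (ac , ca) , (bc , cb)) =
  and₃⁺ (and₃⁺ (diag a x) (≡⇒⇔ᵇ ab) (≡⇒⇔ᵇ ac))
        (and₃⁺ (≡⇒⇔ᵇ ba) (diag b y) (≡⇒⇔ᵇ bc))
        (and₃⁺ (≡⇒⇔ᵇ ca) (≡⇒⇔ᵇ cb) (diag c z))
  where
  diag : ∀ u v → ((u <ᵇ u) ⇔ᵇ (v <ᵇ v)) ≡ true
  diag u v = ≡⇒⇔ᵇ (trans (n<ᵇn≡false u) (sym (n<ᵇn≡false v)))

-- The arguments of Agree cannot be inferred from its unfolding, so the lemmas manipulating
-- agreements are stated for pairs of Boolean equations.
sym² : ∀ {u v u′ v′ : Bool} → (u ≡ v) × (u′ ≡ v′) → (v ≡ u) × (v′ ≡ u′)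
sym² (e , e′) = sym e , sym e′

trans² : ∀ {u v w u′ v′ w′ : Bool} → (u ≡ v) × (u′ ≡ v′) → (v ≡ w) × (v′ ≡ w′) → (u ≡ w) × (u′ ≡ w′)
trans² (e , e′) (f , f′) = trans e f , trans e′ f′

≅-sym : ∀ p t → p ≅ t → t ≅ p
≅-sym (_ , _ , _) (_ , _ , _) (e₁ , e₂ , e₃) = sym² e₁ , sym² e₂ , sym² e₃

≅-trans : ∀ p q t → p ≅ q → q ≅ t → p ≅ t
≅-trans (_ , _ , _) (_ , _ , _) (_ , _ , _) (e₁ , e₂ , e₃) (f₁ , f₂ , f₃) =
  trans² e₁ f₁ , trans² e₂ f₂ , trans² e₃ f₃

≅-reverse : ∀ p t → p ≅ t → reverse₃ p ≅ reverse₃ t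
≅-reverse (_ , _ , _) (_ , _ , _) (e₁ , e₂ , e₃) = swap e₃ , swap e₂ , swap e₁

matches-congʳ : ∀ p t t′ → t ≅ t′ → matches p t ≡ matches p t′
matches-congʳ p t t′ t≅t′ = ≡true⇔⇒≡ (mk⇔
  (λ h → ≅⇒matches p t′ (≅-trans p t t′ (matches⇒≅ p t h) t≅t′))
  (λ h → ≅⇒matches p t (≅-trans p t′ t (matches⇒≅ p t′ h) (≅-sym t t′ t≅t′))))

matches-reverse : ∀ p t → matches p (reverse₃ t) ≡ matches (reverse₃ p) t
matches-reverse p t = ≡true⇔⇒≡ (mk⇔
  (≅⇒matches (reverse₃ p) t ∘ ≅-reverse p (reverse₃ t) ∘ matches⇒≅ p (reverse₃ t))
  (≅⇒matches p (reverse₃ t) ∘ ≅-reverse (reverse₃ p) t ∘ matches⇒≅ (reverse₃ p) t))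

complement-<ᵇ : ∀ {m x y} → x < m → y < m → (complement m x <ᵇ complement m y) ≡ (y <ᵇ x)
complement-<ᵇ {m} {x} {y} x<m y<m with y <? x
... | yes y<x = trans (<⇒<ᵇ≡true (∸-monoʳ-< (s<s y<x) x<m)) (sym (<⇒<ᵇ≡true y<x))
... | no  y≮x = trans (≮⇒<ᵇ≡false (≤⇒≯ (∸-monoʳ-≤ m (s≤s (≮⇒≥ y≮x))))) (sym (≮⇒<ᵇ≡false y≮x))

Bounded : ℕ → Triple → Set
Bounded m t = All (_< m) ⟦ t ⟧

≅-complement : ∀ {m} p t → Bounded m t → p ≅ map₃ (complement m) t ⇔ p ≅ᵒᵖ t
≅-complement (a , b , c) (x , y , z) (x<m ∷ y<m ∷ z<m ∷ [])
  rewrite complement-<ᵇ x<m y<m | complement-<ᵇ y<m x<m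
        | complement-<ᵇ x<m z<m | complement-<ᵇ z<m x<m
        | complement-<ᵇ y<m z<m | complement-<ᵇ z<m y<m
  = mk⇔ swap³ swap³
  where
  swap³ : ∀ {P P′ Q Q′ R R′ : Set} → (P × P′) × (Q × Q′) × (R × R′) → (P′ × P) × (Q′ × Q) × (R′ × R)
  swap³ (e₁ , e₂ , e₃) = swap e₁ , swap e₂ , swap e₃

matches-complement : ∀ {m} p q t → Bounded m t → (p ≅ᵒᵖ t ⇔ q ≅ t) →
                     matches p (map₃ (complement m) t) ≡ matches q t
matches-complement {m} p q t t<m p≅ᵒᵖt⇔q≅t = ≡true⇔⇒≡ (mk⇔
  (≅⇒matches q t ∘ Equivalence.to p≅ᵒᵖt⇔q≅t ∘ Equivalence.to (≅-complement p t t<m) ∘ matches⇒≅ p t′)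
  (≅⇒matches p t′ ∘ Equivalence.from (≅-complement p t t<m) ∘ Equivalence.from p≅ᵒᵖt⇔q≅t ∘ matches⇒≅ q t))
  where
  t′ : Triple
  t′ = map₃ (complement m) t

Distinct : Triple → Set
Distinct (x , y , z) = x ≢ y × y ≢ z × x ≢ z

S₃ : List Triple
S₃ = (1 , 2 , 3) ∷ (1 , 3 , 2) ∷ (2 , 1 , 3) ∷ (2 , 3 , 1) ∷ (3 , 1 , 2) ∷ (3 , 2 , 1) ∷ []

-- The results are Agree x y a b for all numerals a < b, resp. a > b.
<⇒agree : ∀ {x y} → x < y → ((x <ᵇ y) ≡ true) × ((y <ᵇ x) ≡ false)
<⇒agree x<y = <⇒<ᵇ≡true x<y , ≮⇒<ᵇ≡false (<⇒≯ x<y)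

>⇒agree : ∀ {x y} → y < x → ((x <ᵇ y) ≡ false) × ((y <ᵇ x) ≡ true)
>⇒agree = swap ∘ <⇒agree

classify : ∀ t → Distinct t → ∃ λ q → q ∈ S₃ × t ≅ q
classify (x , y , z) (x≢y , y≢z , x≢z) with <-cmp x y | <-cmp y z
... | tri≈ _ x≡y _ | _            = contradiction x≡y x≢y
... | _            | tri≈ _ y≡z _ = contradiction y≡z y≢z
... | tri< x<y _ _ | tri< y<z _ _ =
  _ , here refl , <⇒agree x<y , <⇒agree (<-trans x<y y<z) , <⇒agree y<z
... | tri> _ _ y<x | tri> _ _ z<y =
  _ , there (there (there (there (there (here refl))))) , >⇒agree y<x , >⇒agree (<-trans z<y y<x) , >⇒agree z<y
... | tri< x<y _ _ | tri> _ _ z<y with <-cmp x z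
...   | tri< x<z _ _ = _ , there (here refl) , <⇒agree x<y , <⇒agree x<z , >⇒agree z<y
...   | tri≈ _ x≡z _ = contradiction x≡z x≢z
...   | tri> _ _ z<x = _ , there (there (there (here refl))) , <⇒agree x<y , >⇒agree z<x , >⇒agree z<y
classify (x , y , z) (x≢y , y≢z , x≢z) | tri> _ _ y<x | tri< y<z _ _ with <-cmp x z
...   | tri< x<z _ _ = _ , there (there (here refl)) , >⇒agree y<x , <⇒agree x<z , <⇒agree y<z
...   | tri≈ _ x≡z _ = contradiction x≡z x≢z
...   | tri> _ _ z<x = _ , there (there (there (there (here refl)))) , >⇒agree y<x , >⇒agree z<x , <⇒agree y<z

≡ᵇ⇔≡ : ∀ m n → (m ≡ᵇ n) ≡ true ⇔ m ≡ n
≡ᵇ⇔≡ m n = mk⇔ (≡ᵇ⇒≡ m n ∘ Equivalence.from T-≡) (Equivalence.to T-≡ ∘ ≡⇒≡ᵇ m n)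

≡ᵇ-sym : ∀ m n → (m ≡ᵇ n) ≡ (n ≡ᵇ m)
≡ᵇ-sym m n = ≡true⇔⇒≡ (mk⇔ (Equivalence.from (≡ᵇ⇔≡ n m) ∘ sym ∘ Equivalence.to (≡ᵇ⇔≡ m n))
                            (Equivalence.from (≡ᵇ⇔≡ m n) ∘ sym ∘ Equivalence.to (≡ᵇ⇔≡ n m)))

elemᵇ≡false⇔ : ∀ x xs → elemᵇ x xs ≡ false ⇔ All (x ≢_) xs
elemᵇ≡false⇔ x xs = mk⇔ (to xs) (from xs)
  where
  to : ∀ xs → elemᵇ x xs ≡ false → All (x ≢_) xs
  to []       _ = []
  to (y ∷ ys) h with x ≡ᵇ y in x≡ᵇy
  ... | false = (λ x≡y → contradiction (trans (sym x≡ᵇy) (Equivalence.from (≡ᵇ⇔≡ x y) x≡y)) λ ()) ∷ to ys h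
  from : ∀ xs → All (x ≢_) xs → elemᵇ x xs ≡ false
  from []       []           = refl
  from (y ∷ ys) (x≢y ∷ x∉ys) with x ≡ᵇ y in x≡ᵇy
  ... | true  = contradiction (Equivalence.to (≡ᵇ⇔≡ x y) x≡ᵇy) x≢y
  ... | false = from ys x∉ys

distinctᵇ-∷ : ∀ x xs → distinctᵇ (x ∷ xs) ≡ true ⇔ (All (x ≢_) xs × distinctᵇ xs ≡ true)
distinctᵇ-∷ x xs = mk⇔ to from
  where
  to : distinctᵇ (x ∷ xs) ≡ true → All (x ≢_) xs × distinctᵇ xs ≡ true
  to h with elemᵇ x xs in x∈xs
  ... | false = Equivalence.to (elemᵇ≡false⇔ x xs) x∈xs , h
  from : All (x ≢_) xs × distinctᵇ xs ≡ true → distinctᵇ (x ∷ xs) ≡ true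
  from (x∉xs , h) rewrite Equivalence.from (elemᵇ≡false⇔ x xs) x∉xs = h

elemᵇ-∷ʳ : ∀ a xs b → elemᵇ a (xs ∷ʳ b) ≡ elemᵇ a xs ∨ (a ≡ᵇ b)
elemᵇ-∷ʳ a []       b = ∨-identityʳ (a ≡ᵇ b)
elemᵇ-∷ʳ a (x ∷ xs) b = trans (cong ((a ≡ᵇ x) ∨_) (elemᵇ-∷ʳ a xs b)) (sym (∨-assoc (a ≡ᵇ x) _ _))

elemᵇ-reverse : ∀ a xs → elemᵇ a (reverse xs) ≡ elemᵇ a xs
elemᵇ-reverse a []       = refl
elemᵇ-reverse a (x ∷ xs) = begin
  elemᵇ a (reverse (x ∷ xs))      ≡⟨ cong (elemᵇ a) (unfold-reverse x xs) ⟩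
  elemᵇ a (reverse xs ∷ʳ x)       ≡⟨ elemᵇ-∷ʳ a (reverse xs) x ⟩
  elemᵇ a (reverse xs) ∨ (a ≡ᵇ x) ≡⟨ cong (_∨ (a ≡ᵇ x)) (elemᵇ-reverse a xs) ⟩
  elemᵇ a xs ∨ (a ≡ᵇ x)           ≡⟨ ∨-comm (elemᵇ a xs) (a ≡ᵇ x) ⟩
  elemᵇ a (x ∷ xs)                ∎
  where open ≡-Reasoning

distinctᵇ-∷ʳ : ∀ xs a → distinctᵇ (xs ∷ʳ a) ≡ distinctᵇ (a ∷ xs)
distinctᵇ-∷ʳ []       a = refl
distinctᵇ-∷ʳ (x ∷ xs) a
  rewrite elemᵇ-∷ʳ x xs a | distinctᵇ-∷ʳ xs a | ≡ᵇ-sym x a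
  = shuffle (elemᵇ x xs) (a ≡ᵇ x) (elemᵇ a xs) (distinctᵇ xs)
  where
  shuffle : ∀ u v w d → not (u ∨ v) ∧ (not w ∧ d) ≡ not (v ∨ w) ∧ (not u ∧ d)
  shuffle true  true  _     _ = refl
  shuffle true  false true  _ = refl
  shuffle true  false false _ = refl
  shuffle false true  _     _ = refl
  shuffle false false true  _ = refl
  shuffle false false false _ = refl

distinctᵇ-reverse : ∀ xs → distinctᵇ (reverse xs) ≡ distinctᵇ xs
distinctᵇ-reverse []       = refl
distinctᵇ-reverse (x ∷ xs)
  rewrite unfold-reverse x xs | distinctᵇ-∷ʳ (reverse xs) x | elemᵇ-reverse x xs | distinctᵇ-reverse xs
  = refl

complement-≡ᵇ : ∀ {m x y} → x < m → y < m → (complement m x ≡ᵇ complement m y) ≡ (x ≡ᵇ y)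
complement-≡ᵇ {m} {x} {y} x<m y<m = ≡true⇔⇒≡ (mk⇔
  (Equivalence.from (≡ᵇ⇔≡ x y) ∘ suc-injective ∘ ∸-cancelˡ-≡ x<m y<m ∘ Equivalence.to (≡ᵇ⇔≡ _ _))
  (Equivalence.from (≡ᵇ⇔≡ _ _) ∘ cong (complement m) ∘ Equivalence.to (≡ᵇ⇔≡ x y)))

elemᵇ-complement : ∀ {m x xs} → x < m → All (_< m) xs →
                   elemᵇ (complement m x) (map (complement m) xs) ≡ elemᵇ x xs
elemᵇ-complement x<m []          = refl
elemᵇ-complement x<m (y<m ∷ ys<m) = cong₂ _∨_ (complement-≡ᵇ x<m y<m) (elemᵇ-complement x<m ys<m)

distinctᵇ-complement : ∀ {m xs} → All (_< m) xs → distinctᵇ (map (complement m) xs) ≡ distinctᵇ xs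
distinctᵇ-complement []           = refl
distinctᵇ-complement (x<m ∷ xs<m) =
  cong₂ _∧_ (cong not (elemᵇ-complement x<m xs<m)) (distinctᵇ-complement xs<m)

-- Windows

ind : Bool → ℕ
ind b = if b then 1 else 0

alternating : List Triple
alternating = (1 , 3 , 2) ∷ (2 , 1 , 3) ∷ (2 , 3 , 1) ∷ (3 , 1 , 2) ∷ []

alternating-S₃ : ∀ {q} → q ∈ S₃ → matches (1 , 2 , 3) q ≡ false → matches (3 , 2 , 1) q ≡ false →
                 ∑ alternating (λ p → ind (matches p q)) ≡ 1
alternating-S₃ (here refl) ()
alternating-S₃ (there (here refl)) _ _ = refl
alternating-S₃ (there (there (here refl))) _ _ = refl
alternating-S₃ (there (there (there (here refl)))) _ _ = refl
alternating-S₃ (there (there (there (there (here refl))))) _ _ = refl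
alternating-S₃ (there (there (there (there (there (here refl)))))) _ ()

window-alternating : ∀ t → Distinct t → matches (1 , 2 , 3) t ≡ false → matches (3 , 2 , 1) t ≡ false →
                     ∑ alternating (λ p → ind (matches p t)) ≡ 1
window-alternating t d ¬123 ¬321 with q , q∈S₃ , t≅q ← classify t d =
  trans (∑-cong alternating (λ p → cong ind (matches-congʳ p t q t≅q)))
        (alternating-S₃ q∈S₃ (trans (sym (matches-congʳ (1 , 2 , 3) t q t≅q)) ¬123)
                             (trans (sym (matches-congʳ (3 , 2 , 1) t q t≅q)) ¬321))

windows : List ℕ → List Triple
windows (x ∷ y ∷ z ∷ w) = (x , y , z) ∷ windows (y ∷ z ∷ w)
windows _               = []

occ-windows : ∀ p w → occ ⟦ p ⟧ w ≡ ∑ (windows w) (ind ∘ matches p)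
occ-windows p []              = refl
occ-windows p (_ ∷ [])        = refl
occ-windows p (_ ∷ _ ∷ [])    = refl
occ-windows p (x ∷ y ∷ z ∷ w) = cong (ind (matches p (x , y , z)) +_) (occ-windows p (y ∷ z ∷ w))

length-windows : ∀ w → length (windows w) ≡ length w ∸ 2
length-windows []              = refl
length-windows (_ ∷ [])        = refl
length-windows (_ ∷ _ ∷ [])    = refl
length-windows (_ ∷ y ∷ z ∷ w) = cong suc (length-windows (y ∷ z ∷ w))

windows-map : ∀ f w → windows (map f w) ≡ map (map₃ f) (windows w)
windows-map f []              = refl
windows-map f (_ ∷ [])        = refl
windows-map f (_ ∷ _ ∷ [])    = refl
windows-map f (x ∷ y ∷ z ∷ w) = cong ((f x , f y , f z) ∷_) (windows-map f (y ∷ z ∷ w))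

windows-All : ∀ {P : ℕ → Set} {w} → All P w → All (All P ∘ ⟦_⟧) (windows w)
windows-All []                  = []
windows-All (_ ∷ [])            = []
windows-All (_ ∷ _ ∷ [])        = []
windows-All (px ∷ py ∷ pz ∷ pw) = (px ∷ py ∷ pz ∷ []) ∷ windows-All (py ∷ pz ∷ pw)

lastWindow : List ℕ → ℕ → List Triple
lastWindow (a ∷ b ∷ [])     x = (a , b , x) ∷ []
lastWindow (_ ∷ b ∷ c ∷ w) x = lastWindow (b ∷ c ∷ w) x
lastWindow _               x = []

windows-∷ʳ : ∀ w x → windows (w ∷ʳ x) ≡ windows w ++ lastWindow w x
windows-∷ʳ []              x = refl
windows-∷ʳ (_ ∷ [])        x = refl
windows-∷ʳ (_ ∷ _ ∷ [])    x = refl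
windows-∷ʳ (a ∷ b ∷ c ∷ w) x = cong ((a , b , c) ∷_) (windows-∷ʳ (b ∷ c ∷ w) x)

lastWindow-∷ʳ : ∀ w a b x → lastWindow (w ∷ʳ a ∷ʳ b) x ≡ (a , b , x) ∷ []
lastWindow-∷ʳ []              a b x = refl
lastWindow-∷ʳ (_ ∷ [])        a b x = refl
lastWindow-∷ʳ (_ ∷ d ∷ [])    a b x = refl
lastWindow-∷ʳ (_ ∷ d ∷ e ∷ w) a b x = lastWindow-∷ʳ (d ∷ e ∷ w) a b x

windows-reverse : ∀ w → windows (reverse w) ≡ reverse (map reverse₃ (windows w))
windows-reverse []              = refl
windows-reverse (_ ∷ [])        = refl
windows-reverse (_ ∷ _ ∷ [])    = refl
windows-reverse (x ∷ y ∷ z ∷ w) = begin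
  windows (reverse (x ∷ y ∷ z ∷ w))
    ≡⟨ cong windows (unfold-reverse x (y ∷ z ∷ w)) ⟩
  windows (reverse (y ∷ z ∷ w) ∷ʳ x)
    ≡⟨ windows-∷ʳ (reverse (y ∷ z ∷ w)) x ⟩
  windows (reverse (y ∷ z ∷ w)) ++ lastWindow (reverse (y ∷ z ∷ w)) x
    ≡⟨ cong₂ _++_ (windows-reverse (y ∷ z ∷ w)) lastWindow-reverse ⟩
  reverse (map reverse₃ (windows (y ∷ z ∷ w))) ∷ʳ (z , y , x)
    ≡⟨ unfold-reverse (z , y , x) (map reverse₃ (windows (y ∷ z ∷ w))) ⟨
  reverse (map reverse₃ (windows (x ∷ y ∷ z ∷ w))) ∎
  where
  open ≡-Reasoning
  lastWindow-reverse : lastWindow (reverse (y ∷ z ∷ w)) x ≡ (z , y , x) ∷ []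
  lastWindow-reverse = begin
    lastWindow (reverse (y ∷ z ∷ w)) x  ≡⟨ cong (λ v → lastWindow v x) (unfold-reverse y (z ∷ w)) ⟩
    lastWindow (reverse (z ∷ w) ∷ʳ y) x ≡⟨ cong (λ v → lastWindow (v ∷ʳ y) x) (unfold-reverse z w) ⟩
    lastWindow (reverse w ∷ʳ z ∷ʳ y) x  ≡⟨ lastWindow-∷ʳ (reverse w) z y x ⟩
    (z , y , x) ∷ []                    ∎

occ-reverse : ∀ p w → occ ⟦ p ⟧ (reverse w) ≡ occ ⟦ reverse₃ p ⟧ w
occ-reverse p w = begin
  occ ⟦ p ⟧ (reverse w)
    ≡⟨ occ-windows p (reverse w) ⟩
  ∑ (windows (reverse w)) (ind ∘ matches p)
    ≡⟨ cong (λ ts → ∑ ts (ind ∘ matches p)) (windows-reverse w) ⟩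
  ∑ (reverse (map reverse₃ (windows w))) (ind ∘ matches p)
    ≡⟨ ∑-reverse (map reverse₃ (windows w)) _ ⟩
  ∑ (map reverse₃ (windows w)) (ind ∘ matches p)
    ≡⟨ ∑-map (windows w) reverse₃ _ ⟩
  ∑ (windows w) (ind ∘ matches p ∘ reverse₃)
    ≡⟨ ∑-cong (windows w) (cong ind ∘ matches-reverse p) ⟩
  ∑ (windows w) (ind ∘ matches (reverse₃ p))
    ≡⟨ occ-windows (reverse₃ p) w ⟨
  occ ⟦ reverse₃ p ⟧ w ∎
  where open ≡-Reasoning

occ-complement : ∀ {m} p q w → All (_< m) w → (∀ t → p ≅ᵒᵖ t ⇔ q ≅ t) →
                 occ ⟦ p ⟧ (map (complement m) w) ≡ occ ⟦ q ⟧ w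
occ-complement {m} p q w w<m p≅ᵒᵖ⇔q≅ = begin
  occ ⟦ p ⟧ (map (complement m) w)
    ≡⟨ occ-windows p (map (complement m) w) ⟩
  ∑ (windows (map (complement m) w)) (ind ∘ matches p)
    ≡⟨ cong (λ ts → ∑ ts (ind ∘ matches p)) (windows-map (complement m) w) ⟩
  ∑ (map (map₃ (complement m)) (windows w)) (ind ∘ matches p)
    ≡⟨ ∑-map (windows w) (map₃ (complement m)) _ ⟩
  ∑ (windows w) (ind ∘ matches p ∘ map₃ (complement m))
    ≡⟨ ∑-congᴬ (All.map (λ {t} t<m → cong ind (matches-complement p q t t<m (p≅ᵒᵖ⇔q≅ t))) (windows-All w<m)) ⟩
  ∑ (windows w) (ind ∘ matches q)
    ≡⟨ occ-windows q w ⟨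
  occ ⟦ q ⟧ w ∎
  where open ≡-Reasoning

distinct-window : ∀ x y z w → distinctᵇ (x ∷ y ∷ z ∷ w) ≡ true → Distinct (x , y , z)
distinct-window x y z w h
  with x≢y ∷ x≢z ∷ _ , h′ ← Equivalence.to (distinctᵇ-∷ x (y ∷ z ∷ w)) h
  with y≢z ∷ _ , _ ← Equivalence.to (distinctᵇ-∷ y (z ∷ w)) h′
  = x≢y , y≢z , x≢z

windows-distinct : ∀ w → distinctᵇ w ≡ true → All Distinct (windows w)
windows-distinct []              _ = []
windows-distinct (_ ∷ [])        _ = []
windows-distinct (_ ∷ _ ∷ [])    _ = []
windows-distinct (x ∷ y ∷ z ∷ w) h =
  distinct-window x y z w h ∷ windows-distinct (y ∷ z ∷ w) (proj₂ (Equivalence.to (distinctᵇ-∷ x (y ∷ z ∷ w)) h))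

no-window-matches : ∀ p w → occ ⟦ p ⟧ w ≡ 0 → All (λ t → matches p t ≡ false) (windows w)
no-window-matches p w occ≡0 = All.map ind≡0 (∑≡0⇒All (windows w) (trans (sym (occ-windows p w)) occ≡0))
  where
  ind≡0 : ∀ {b} → ind b ≡ 0 → b ≡ false
  ind≡0 {false} _ = refl

occ-alternating : ∀ w → distinctᵇ w ≡ true → occ ⟦ 1 , 2 , 3 ⟧ w ≡ 0 → occ ⟦ 3 , 2 , 1 ⟧ w ≡ 0 →
                  ∑ alternating (λ p → occ ⟦ p ⟧ w) ≡ length w ∸ 2
occ-alternating w distinct no123 no321 = begin
  ∑ alternating (λ p → occ ⟦ p ⟧ w)
    ≡⟨ ∑-cong alternating (λ p → occ-windows p w) ⟩
  ∑ alternating (λ p → ∑ (windows w) (ind ∘ matches p))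
    ≡⟨ ∑-swap alternating (windows w) (λ p t → ind (matches p t)) ⟩
  ∑ (windows w) (λ t → ∑ alternating (λ p → ind (matches p t)))
    ≡⟨ ∑-congᴬ (All.zipWith (λ (d , ¬123 , ¬321) → window-alternating _ d ¬123 ¬321)
                 (windows-distinct w distinct ,
                  All.zip (no-window-matches (1 , 2 , 3) w no123 , no-window-matches (3 , 2 , 1) w no321))) ⟩
  ∑ (windows w) (λ _ → 1)
    ≡⟨ ∑-const (windows w) 1 ⟩
  1 * length (windows w)
    ≡⟨ trans (*-identityˡ _) (length-windows w) ⟩
  length w ∸ 2 ∎
  where open ≡-Reasoning

-- The class 𝒜 and its symmetries

-- Literally the predicate of Av in Defs, so that 𝒜 n is a double filter of words n n.
avoids : List ℕ → Bool
avoids w = all (λ p → occ p w ≡ᵇ 0) ((1 ∷ 2 ∷ 3 ∷ []) ∷ (3 ∷ 2 ∷ 1 ∷ []) ∷ [])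

inClass : List ℕ → Bool
inClass w = distinctᵇ w ∧ avoids w

𝒜≡filter : ∀ n → 𝒜 n ≡ filterᵇ inClass (words n n)
𝒜≡filter n = filterᵇ-filterᵇ avoids distinctᵇ (words n n)

inClass⇒ : ∀ w → inClass w ≡ true →
           distinctᵇ w ≡ true × occ ⟦ 1 , 2 , 3 ⟧ w ≡ 0 × occ ⟦ 3 , 2 , 1 ⟧ w ≡ 0
inClass⇒ w h with d , a₁ , a₂ ← and₃⁻ (distinctᵇ w) (occ ⟦ 1 , 2 , 3 ⟧ w ≡ᵇ 0) (occ ⟦ 3 , 2 , 1 ⟧ w ≡ᵇ 0) h
  = d , Equivalence.to (≡ᵇ⇔≡ _ 0) a₁ , Equivalence.to (≡ᵇ⇔≡ _ 0) a₂

∧-true-comm : ∀ u v → u ∧ (v ∧ true) ≡ v ∧ (u ∧ true)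
∧-true-comm true  v     = refl
∧-true-comm false true  = refl
∧-true-comm false false = refl

inClass-reverse : ∀ w → inClass (reverse w) ≡ inClass w
inClass-reverse w
  rewrite distinctᵇ-reverse w | occ-reverse (1 , 2 , 3) w | occ-reverse (3 , 2 , 1) w
  = cong (distinctᵇ w ∧_) (∧-true-comm (occ ⟦ 3 , 2 , 1 ⟧ w ≡ᵇ 0) (occ ⟦ 1 , 2 , 3 ⟧ w ≡ᵇ 0))

inClass-complement : ∀ {m} w → All (_< m) w → inClass (map (complement m) w) ≡ inClass w
inClass-complement w w<m
  rewrite distinctᵇ-complement w<m
        | occ-complement (1 , 2 , 3) (3 , 2 , 1) w w<m (λ _ → mk⇔ id id)
        | occ-complement (3 , 2 , 1) (1 , 2 , 3) w w<m (λ _ → mk⇔ id id)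
  = cong (distinctᵇ w ∧_) (∧-true-comm (occ ⟦ 3 , 2 , 1 ⟧ w ≡ᵇ 0) (occ ⟦ 1 , 2 , 3 ⟧ w ≡ᵇ 0))

totalOcc-reverse : ∀ p n → totalOcc 𝒜 ⟦ reverse₃ p ⟧ n ≡ totalOcc 𝒜 ⟦ p ⟧ n
totalOcc-reverse p n rewrite 𝒜≡filter n = begin
  ∑ (filterᵇ inClass (words n n)) (occ ⟦ reverse₃ p ⟧)
    ≡⟨ ∑-cong (filterᵇ inClass (words n n)) (sym ∘ occ-reverse p) ⟩
  ∑ (filterᵇ inClass (words n n)) (occ ⟦ p ⟧ ∘ reverse)
    ≡⟨ ∑-filterᵇ-invariant inClass (words n n) reverse (∑-words-reverse n n)
                           (All.universal inClass-reverse _) (occ ⟦ p ⟧) ⟩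
  ∑ (filterᵇ inClass (words n n)) (occ ⟦ p ⟧) ∎
  where open ≡-Reasoning

totalOcc-complement : ∀ p q n → (∀ t → p ≅ᵒᵖ t ⇔ q ≅ t) → totalOcc 𝒜 ⟦ q ⟧ n ≡ totalOcc 𝒜 ⟦ p ⟧ n
totalOcc-complement p q n p≅ᵒᵖ⇔q≅ rewrite 𝒜≡filter n = begin
  ∑ (filterᵇ inClass (words n n)) (occ ⟦ q ⟧)
    ≡⟨ ∑-filterᵇ-congᴬ inClass (All.map (λ {w} w<n _ → sym (occ-complement p q w w<n p≅ᵒᵖ⇔q≅)) (words-bounded n)) ⟩
  ∑ (filterᵇ inClass (words n n)) (occ ⟦ p ⟧ ∘ map (complement n))
    ≡⟨ ∑-filterᵇ-invariant inClass (words n n) (map (complement n)) (∑-words-complement n n)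
                           (All.map (inClass-complement _) (words-bounded n)) (occ ⟦ p ⟧) ⟩
  ∑ (filterᵇ inClass (words n n)) (occ ⟦ p ⟧) ∎
  where open ≡-Reasoning

totalOcc-alternating : ∀ n → ∑ alternating (λ p → totalOcc 𝒜 ⟦ p ⟧ n) ≡ (n ∸ 2) * length (𝒜 n)
totalOcc-alternating n = begin
  ∑ alternating (λ p → ∑ (𝒜 n) (occ ⟦ p ⟧))
    ≡⟨ ∑-swap alternating (𝒜 n) (λ p → occ ⟦ p ⟧) ⟩
  ∑ (𝒜 n) (λ w → ∑ alternating (λ p → occ ⟦ p ⟧ w))
    ≡⟨ cong (λ A → ∑ A (λ w → ∑ alternating (λ p → occ ⟦ p ⟧ w))) (𝒜≡filter n) ⟩
  ∑ (filterᵇ inClass (words n n)) (λ w → ∑ alternating (λ p → occ ⟦ p ⟧ w))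
    ≡⟨ ∑-filterᵇ-congᴬ inClass (All.tabulate (λ {w} w∈ h → alternating-count w (proj₁ (∈-words⁻ n n w∈)) h)) ⟩
  ∑ (filterᵇ inClass (words n n)) (λ _ → n ∸ 2)
    ≡⟨ cong (λ A → ∑ A (λ _ → n ∸ 2)) (𝒜≡filter n) ⟨
  ∑ (𝒜 n) (λ _ → n ∸ 2)
    ≡⟨ ∑-const (𝒜 n) (n ∸ 2) ⟩
  (n ∸ 2) * length (𝒜 n) ∎
  where
  open ≡-Reasoning
  alternating-count : ∀ w → length w ≡ n → inClass w ≡ true → ∑ alternating (λ p → occ ⟦ p ⟧ w) ≡ n ∸ 2
  alternating-count w refl h with d , no123 , no321 ← inClass⇒ w h = occ-alternating w d no123 no321

totalOcc-alternating-≡ : ∀ {p} n → p ∈ alternating → totalOcc 𝒜 ⟦ p ⟧ n ≡ totalOcc 𝒜 ⟦ 1 , 3 , 2 ⟧ n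
totalOcc-alternating-≡ n (here refl) = refl
totalOcc-alternating-≡ n (there (here refl)) =
  trans (totalOcc-complement (2 , 3 , 1) (2 , 1 , 3) n (λ _ → mk⇔ id id)) (totalOcc-reverse (1 , 3 , 2) n)
totalOcc-alternating-≡ n (there (there (here refl))) = totalOcc-reverse (1 , 3 , 2) n
totalOcc-alternating-≡ n (there (there (there (here refl)))) =
  totalOcc-complement (1 , 3 , 2) (3 , 1 , 2) n (λ _ → mk⇔ id id)

four-totalOcc : ∀ {p} n → p ∈ alternating → 4 * totalOcc 𝒜 ⟦ p ⟧ n ≡ (n ∸ 2) * length (𝒜 n)
four-totalOcc {p} n p∈ = begin
  4 * totalOcc 𝒜 ⟦ p ⟧ n                          ≡⟨ cong (4 *_) (totalOcc-alternating-≡ n p∈) ⟩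
  4 * totalOcc 𝒜 ⟦ 1 , 3 , 2 ⟧ n                  ≡⟨ *-comm 4 (totalOcc 𝒜 ⟦ 1 , 3 , 2 ⟧ n) ⟩
  totalOcc 𝒜 ⟦ 1 , 3 , 2 ⟧ n * length alternating ≡⟨ ∑-const alternating (totalOcc 𝒜 ⟦ 1 , 3 , 2 ⟧ n) ⟨
  ∑ alternating (λ _ → totalOcc 𝒜 ⟦ 1 , 3 , 2 ⟧ n) ≡⟨ ∑-congᴬ (All.tabulate (sym ∘ totalOcc-alternating-≡ n)) ⟩
  ∑ alternating (λ q → totalOcc 𝒜 ⟦ q ⟧ n)        ≡⟨ totalOcc-alternating n ⟩
  (n ∸ 2) * length (𝒜 n)                          ∎
  where open ≡-Reasoning

-- A zigzag permutation in every 𝒜ₙ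

≢true⇒≡false : ∀ {b} → b ≢ true → b ≡ false
≢true⇒≡false = ¬-not

NonMonotone : Triple → Set
NonMonotone (x , y , z) = (y < x × y < z) ⊎ (x < y × z < y)

matches-123⇒ : ∀ x y z → matches (1 , 2 , 3) (x , y , z) ≡ true → x < y × y < z
matches-123⇒ x y z h with (x<ᵇy , _) , _ , (y<ᵇz , _) ← matches⇒≅ (1 , 2 , 3) (x , y , z) h =
  <ᵇ≡true⇒< x y (sym x<ᵇy) , <ᵇ≡true⇒< y z (sym y<ᵇz)

matches-321⇒ : ∀ x y z → matches (3 , 2 , 1) (x , y , z) ≡ true → y < x × z < y
matches-321⇒ x y z h with (_ , y<ᵇx) , _ , (_ , z<ᵇy) ← matches⇒≅ (3 , 2 , 1) (x , y , z) h =
  <ᵇ≡true⇒< y x (sym y<ᵇx) , <ᵇ≡true⇒< z y (sym z<ᵇy)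

nonMonotone-avoids : ∀ t → NonMonotone t → matches (1 , 2 , 3) t ≡ false × matches (3 , 2 , 1) t ≡ false
nonMonotone-avoids (x , y , z) (inj₁ (y<x , y<z)) =
  ≢true⇒≡false (λ h → <-asym (proj₁ (matches-123⇒ x y z h)) y<x) ,
  ≢true⇒≡false (λ h → <-asym (proj₂ (matches-321⇒ x y z h)) y<z)
nonMonotone-avoids (x , y , z) (inj₂ (x<y , z<y)) =
  ≢true⇒≡false (λ h → <-asym (proj₂ (matches-123⇒ x y z h)) z<y) ,
  ≢true⇒≡false (λ h → <-asym (proj₁ (matches-321⇒ x y z h)) x<y)

zigzag : ℕ → ℕ → List ℕ
zigzag k zero          = []
zigzag k (suc zero)    = k ∷ []
zigzag k (suc (suc r)) = suc k ∷ k ∷ zigzag (suc (suc k)) r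

length-zigzag : ∀ k r → length (zigzag k r) ≡ r
length-zigzag k zero          = refl
length-zigzag k (suc zero)    = refl
length-zigzag k (suc (suc r)) = cong (suc ∘ suc) (length-zigzag (suc (suc k)) r)

zigzag-lower : ∀ k r → All (k ≤_) (zigzag k r)
zigzag-lower k zero          = []
zigzag-lower k (suc zero)    = ≤-refl ∷ []
zigzag-lower k (suc (suc r)) =
  n≤1+n k ∷ ≤-refl ∷ All.map (≤-trans (≤-trans (n≤1+n k) (n≤1+n (suc k)))) (zigzag-lower (suc (suc k)) r)

zigzag-upper : ∀ {n} k r → k + r ≤ n → All (_< n) (zigzag k r)
zigzag-upper     k zero          _     = []
zigzag-upper {n} k (suc zero)    k+1≤n = subst (_≤ n) (+-comm k 1) k+1≤n ∷ []
zigzag-upper {n} k (suc (suc r)) k+r+2≤n =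
  ≤-trans (s≤s (s≤s (m≤m+n k r))) k+2+r≤n ∷ ≤-trans (s≤s (≤-trans (m≤m+n k r) (n≤1+n _))) k+2+r≤n ∷
  zigzag-upper (suc (suc k)) r k+2+r≤n
  where
  k+2+r≤n : suc (suc (k + r)) ≤ n
  k+2+r≤n = subst (_≤ n) (trans (+-suc k (suc r)) (cong suc (+-suc k r))) k+r+2≤n

distinctᵇ-zigzag : ∀ k r → distinctᵇ (zigzag k r) ≡ true
distinctᵇ-zigzag k zero          = refl
distinctᵇ-zigzag k (suc zero)    = refl
distinctᵇ-zigzag k (suc (suc r)) =
  Equivalence.from (distinctᵇ-∷ (suc k) (k ∷ rest))
    (1+n≢n ∷ All.map <⇒≢ (zigzag-lower (suc (suc k)) r) ,
     Equivalence.from (distinctᵇ-∷ k rest)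
       (All.map (<⇒≢ ∘ ≤-trans (n≤1+n (suc k))) (zigzag-lower (suc (suc k)) r) , distinctᵇ-zigzag (suc (suc k)) r))
  where
  rest : List ℕ
  rest = zigzag (suc (suc k)) r

zigzag-nonMonotone : ∀ k r → All NonMonotone (windows (zigzag k r))
zigzag-nonMonotone k zero                      = []
zigzag-nonMonotone k (suc zero)                = []
zigzag-nonMonotone k (suc (suc zero))          = []
zigzag-nonMonotone k (suc (suc (suc zero)))    = inj₁ (≤-refl , n≤1+n _) ∷ []
zigzag-nonMonotone k (suc (suc (suc (suc r)))) =
  inj₁ (≤-refl , ≤-trans (n≤1+n _) (n≤1+n _)) ∷ inj₂ (≤-trans (n≤1+n _) (n≤1+n _) , ≤-refl) ∷
  zigzag-nonMonotone (suc (suc k)) (suc (suc r))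

occ-zigzag : ∀ p k r → All (λ t → matches p t ≡ false) (windows (zigzag k r)) → occ ⟦ p ⟧ (zigzag k r) ≡ 0
occ-zigzag p k r none = begin
  occ ⟦ p ⟧ (zigzag k r)                     ≡⟨ occ-windows p (zigzag k r) ⟩
  ∑ (windows (zigzag k r)) (ind ∘ matches p) ≡⟨ ∑-congᴬ (All.map (cong ind) none) ⟩
  ∑ (windows (zigzag k r)) (λ _ → 0)         ≡⟨ ∑-const (windows (zigzag k r)) 0 ⟩
  0                                          ∎
  where open ≡-Reasoning

inClass-zigzag : ∀ n → inClass (zigzag 0 n) ≡ true
inClass-zigzag n = and₃⁺ (distinctᵇ-zigzag 0 n)
  (cong (_≡ᵇ 0) (occ-zigzag (1 , 2 , 3) 0 n (All.map (proj₁ ∘ nonMonotone-avoids _) (zigzag-nonMonotone 0 n))))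
  (cong (_≡ᵇ 0) (occ-zigzag (3 , 2 , 1) 0 n (All.map (proj₂ ∘ nonMonotone-avoids _) (zigzag-nonMonotone 0 n))))

𝒜-nonempty : ∀ n → 1 ≤ length (𝒜 n)
𝒜-nonempty n rewrite 𝒜≡filter n =
  filter-some (T? ∘ inClass) (lose zigzag∈words (Equivalence.from T-≡ (inClass-zigzag n)))
  where
  zigzag∈words : zigzag 0 n ∈ words n n
  zigzag∈words = subst (λ k → zigzag 0 n ∈ words n k) (length-zigzag 0 n) (∈-words⁺ n (zigzag-upper 0 n ≤-refl))

¼ : ℚ
¼ = ℤ.+ 1 / 4

∣4t-[d+1]∣ : ∀ t d y → t * 4 + y ≡ suc d → ℤ.∣ ℤ.+ t ℤ.* ℤ.+ 4 ℤ.+ -[1+ 0 ] ℤ.* ℤ.+ suc d ∣ ≡ y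
∣4t-[d+1]∣ t d y 4t+y≡d+1 = begin
  ℤ.∣ ℤ.+ t ℤ.* ℤ.+ 4 ℤ.+ -[1+ 0 ] ℤ.* ℤ.+ suc d ∣
    ≡⟨ cong ℤ.∣_∣ (cong₂ ℤ._+_ (sym (ℤ.pos-* t 4)) (ℤ.-1*i≡-i (ℤ.+ suc d))) ⟩
  ℤ.∣ ℤ.+ (t * 4) ℤ.+ ℤ.- (ℤ.+ suc d) ∣
    ≡⟨ cong ℤ.∣_∣ (ℤ.m-n≡m⊖n (t * 4) (suc d)) ⟩
  ℤ.∣ t * 4 ℤ.⊖ suc d ∣
    ≡⟨ ℤ.∣⊖∣-≤ (subst (t * 4 ≤_) 4t+y≡d+1 (m≤m+n (t * 4) y)) ⟩
  suc d ∸ t * 4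
    ≡⟨ cong (_∸ t * 4) 4t+y≡d+1 ⟨
  t * 4 + y ∸ t * 4
    ≡⟨ m+n∸m≡n (t * 4) y ⟩
  y ∎
  where open ≡-Reasoning

-- t/(d + 1) − 1/4 = (4t − (d + 1))/4(d + 1), whose absolute value is y/4(d + 1).
ratio-near-¼ : ∀ t d y p q .(c : Coprime (suc p) (suc q)) → t * 4 + y ≡ suc d → y * suc q < suc p * (suc d * 4) →
               ℚ.∣ ratio t (suc d) ℚ.- ¼ ∣ ℚ.< mkℚ +[1+ p ] q c
ratio-near-¼ t d y p q c 4t+y≡d+1 y/4[d+1]<ε =
  ℚ.toℚᵘ-cancel-< (ℚᵘ.<-respˡ-≃ toℚᵘ-distance (ℚᵘ.*<* num<))
  where
  x : ℚ
  x = fromℚᵘ (mkℚᵘ (ℤ.+ t) d)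
  toℚᵘ-distance : ℚᵘ.∣ mkℚᵘ (ℤ.+ t) d ℚᵘ.+ mkℚᵘ -[1+ 0 ] 3 ∣ ℚᵘ.≃ toℚᵘ (ℚ.∣ x ℚ.- ¼ ∣)
  toℚᵘ-distance = ℚᵘ.≃-sym (ℚᵘ.≃-trans (ℚ.toℚᵘ-homo-∣-∣ (x ℚ.- ¼)) (ℚᵘ.∣-∣-cong
    (ℚᵘ.≃-trans (ℚ.toℚᵘ-homo-+ x (ℚ.- ¼)) (ℚᵘ.+-congˡ (mkℚᵘ -[1+ 0 ] 3) (ℚ.toℚᵘ-fromℚᵘ (mkℚᵘ (ℤ.+ t) d))))))
  num< : ℤ.+ ℤ.∣ ℤ.+ t ℤ.* ℤ.+ 4 ℤ.+ -[1+ 0 ] ℤ.* ℤ.+ suc d ∣ ℤ.* ℤ.+ suc q ℤ.< ℤ.+ suc p ℤ.* ℤ.+ (suc d * 4)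
  num< rewrite ∣4t-[d+1]∣ t d y 4t+y≡d+1 =
    subst₂ ℤ._<_ (ℤ.pos-* y (suc q)) (ℤ.pos-* (suc p) (suc d * 4)) (ℤ.+<+ y/4[d+1]<ε)

4t+2a≡[m+2]a : ∀ t a m → 4 * t ≡ m * a → t * 4 + (a + a) ≡ suc (suc m) * a
4t+2a≡[m+2]a t a m 4t≡ma = begin
  t * 4 + (a + a) ≡⟨ cong (_+ (a + a)) (trans (*-comm t 4) 4t≡ma) ⟩
  m * a + (a + a) ≡⟨ solve 2 (λ m a → m :* a :+ (a :+ a) := (con 2 :+ m) :* a) refl m a ⟩
  suc (suc m) * a       ∎
  where
  open ≡-Reasoning
  open +-*-Solver

2a[q+1]<[p+1]4na : ∀ a n p q → suc q ≤ suc n →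
                    (suc a + suc a) * suc q < suc p * (suc n * suc a * 4)
2a[q+1]<[p+1]4na a n p q q+1≤n+1 = begin-strict
  (suc a + suc a) * suc q ≤⟨ *-monoʳ-≤ (suc a + suc a) q+1≤n+1 ⟩
  (suc a + suc a) * suc n ≡⟨ solve 2 (λ a n → (a :+ a) :* n := con 2 :* (n :* a)) refl (suc a) (suc n) ⟩
  2 * b                   <⟨ *-monoˡ-< b {2} {4} (s≤s (s≤s (s≤s z≤n))) ⟩
  4 * b                   ≡⟨ *-comm 4 b ⟩
  b * 4                   ≤⟨ m≤n*m (b * 4) (suc p) ⟩
  suc p * (b * 4)         ∎
  where
  open ≤-Reasoning
  open +-*-Solver
  b : ℕ
  b = suc n * suc a

-- With 4 T n = (n − 2) A n the sequence is (n − 2)/4n, at distance 1/2n from ¼.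
ratio-convergence : ∀ (T A : ℕ → ℕ) → (∀ n → 4 * T n ≡ (n ∸ 2) * A n) → (∀ n → 1 ≤ A n) →
                    ConvergesTo (λ n → ratio (T n) (n * A n)) ¼
ratio-convergence T A 4T≡[n-2]A A≥1 (mkℚ +[1+ p ] q c) _ = suc (suc q) , near
  where
  near : ∀ n → suc (suc q) ≤ n → ℚ.∣ ratio (T n) (n * A n) ℚ.- ¼ ∣ ℚ.< mkℚ +[1+ p ] q c
  near n@(suc (suc m)) (s≤s q+1≤m+1) with A n | A≥1 n | 4T≡[n-2]A n
  ... | suc a | _ | 4t≡ma =
    ratio-near-¼ (T n) _ (suc a + suc a) p q c (4t+2a≡[m+2]a (T n) (suc a) m 4t≡ma)
                 (2a[q+1]<[p+1]4na a (suc m) p q (≤-trans q+1≤m+1 (n≤1+n _)))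
ratio-convergence T A _ _ (mkℚ (ℤ.+ zero) _ _) (ℚ.*<* (ℤ.+<+ ()))
ratio-convergence T A _ _ (mkℚ -[1+ _ ] _ _) (ℚ.*<* ())

open import Data.Integer using (+_)

pop-alternating : ∀ {p} → p ∈ alternating → PopEq 𝒜 ⟦ p ⟧ ¼
pop-alternating {p} p∈ = ratio-convergence (totalOcc 𝒜 ⟦ p ⟧) (length ∘ 𝒜) (λ n → four-totalOcc n p∈) 𝒜-nonempty

mainTheorem9 : PopEq 𝒜 (1 ∷ 3 ∷ 2 ∷ []) ((+ 1) / 4)
             × PopEq 𝒜 (2 ∷ 3 ∷ 1 ∷ []) ((+ 1) / 4)
             × PopEq 𝒜 (3 ∷ 1 ∷ 2 ∷ []) ((+ 1) / 4)
             × PopEq 𝒜 (2 ∷ 1 ∷ 3 ∷ []) ((+ 1) / 4)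
mainTheorem9 = pop-alternating (here refl)
             , pop-alternating (there (there (here refl)))
             , pop-alternating (there (there (there (here refl))))
             , pop-alternating (there (here refl))
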